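{- Let $\alpha$ be a prenaming. Then $\alpha$ is injective on the co-finite set $V\setminus\mathrm{noninj}(\alpha)$, where $\mathrm{noninj}(\alpha)=R^+(\alpha)\setminus C^+(\alpha)$, and this set is maximal among sets of variables containing $C^+(\alpha)$ on which $\alpha$ is injective.
   Context: $V$ is a countably infinite set of variables. A substitution maps variables to terms and is the identity outside the finite set $\mathrm{Dom}(\sigma)=\{x:\sigma(x)\neq x\}$. A prenaming is a substitution $\alpha$ mapping variables to variables together with a fixed finite set $C^+(\alpha)\supseteq\mathrm{Dom}(\alpha)$ (relaxed core) on which $\alpha$ is injective; $R^+(\alpha)=\alpha(C^+(\alpha))$. -}

module Defs where

open import Data.Nat using (ℕ)
open import Data.List using (List)
open import Data.List.Membership.Propositional using (_∈_; _∉_)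
open import Data.Product using (Σ; ∃; _×_)
open import Relation.Binary.PropositionalEquality using (_≡_; _≢_)
open import Relation.Unary using (Pred; _⊆_)
open import Level using (0ℓ)
open import Relation.Nullary using (¬_)

Var : Set
Var = ℕ

-- A prenaming: a variable-to-variable map α together with a finite
-- relaxed core C⁺(α) (given as a list) such that Dom(α) ⊆ C⁺(α)
-- and α is injective on C⁺(α).  (Dom(α) ⊆ C⁺(α) also makes Dom(α)
-- finite, as required for a substitution.)
record Prenaming : Set where
  field
    α      : Var → Var
    core   : List Var
    dom⊆core : ∀ x → α x ≢ x → x ∈ core
    injCore  : ∀ x y → x ∈ core → y ∈ core → α x ≡ α y → x ≡ y

open Prenaming public

C⁺ : Prenaming → Pred Var 0ℓ
C⁺ p x = x ∈ core p

R⁺ : Prenaming → Pred Var 0ℓ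
R⁺ p y = Σ Var (λ c → (c ∈ core p) × (α p c ≡ y))

noninj : Prenaming → Pred Var 0ℓ
noninj p x = R⁺ p x × (x ∉ core p)

goodVars : Prenaming → Pred Var 0ℓ
goodVars p x = ¬ noninj p x

InjectiveOn : (Var → Var) → Pred Var 0ℓ → Set
InjectiveOn f S = ∀ x y → S x → S y → f x ≡ f y → x ≡ y

CoFinite : Pred Var 0ℓ → Set
CoFinite S = Σ (List Var) (λ L → ∀ x → ¬ S x → x ∈ L)

{-# OPTIONS --safe #-}
module Submission where

-- Outside its core a prenaming is the identity, so the only collisions of α
-- are between a core variable c and a non-core variable x = α c, i.e. a
-- variable of noninj(α).  Removing noninj(α) leaves an injective set, and any
-- set containing the core that still met noninj(α) would contain such a pair.

open import Defs
open import Data.Nat using (_≟_)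
open import Data.List using (map)
open import Data.List.Membership.Propositional using (_∈_; _∉_)
open import Data.List.Membership.Propositional.Properties using (∈-map⁺)
open import Data.List.Membership.DecPropositional _≟_ using (_∈?_)
open import Data.Product using (_×_; _,_)
open import Data.Empty using (⊥-elim)
open import Relation.Binary.PropositionalEquality using (_≡_; refl; sym; trans; subst)
open import Relation.Nullary using (yes; no)
open import Relation.Nullary.Decidable using (decidable-stable)
open import Relation.Unary using (Pred; _⊆_)
open import Level using (0ℓ)

module _ (p : Prenaming) where

  ∉core⇒fixed : ∀ {x} → x ∉ core p → α p x ≡ x
  ∉core⇒fixed {x} x∉core with α p x ≟ x
  ... | yes αx≡x = αx≡x
  ... | no αx≢x = ⊥-elim (x∉core (dom⊆core p x αx≢x))

  R⁺⊆image : R⁺ p ⊆ (λ x → x ∈ map (α p) (core p))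
  R⁺⊆image (c , c∈core , refl) = ∈-map⁺ (α p) c∈core

  goodVars-coFinite : CoFinite (goodVars p)
  goodVars-coFinite = image , λ x ¬good →
    decidable-stable (x ∈? image) (λ x∉image → ¬good (λ (x∈R⁺ , _) → x∉image (R⁺⊆image x∈R⁺)))
    where image = map (α p) (core p)

  collision⇒noninj : ∀ {x y} → x ∉ core p → y ∈ core p → α p x ≡ α p y → noninj p x
  collision⇒noninj {y = y} x∉core y∈core αx≡αy =
    (y , y∈core , trans (sym αx≡αy) (∉core⇒fixed x∉core)) , x∉core

  goodVars-injective : InjectiveOn (α p) (goodVars p)
  goodVars-injective x y good-x good-y αx≡αy with x ∈? core p | y ∈? core p
  ... | yes x∈core | yes y∈core = injCore p x y x∈core y∈core αx≡αy
  ... | no x∉core  | no y∉core  =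
    trans (sym (∉core⇒fixed x∉core)) (trans αx≡αy (∉core⇒fixed y∉core))
  ... | no x∉core  | yes y∈core = ⊥-elim (good-x (collision⇒noninj x∉core y∈core αx≡αy))
  ... | yes x∈core | no y∉core  = ⊥-elim (good-y (collision⇒noninj y∉core x∈core (sym αx≡αy)))

  ⊇core-injectiveOn⇒⊆goodVars : ∀ {S : Pred Var 0ℓ} → C⁺ p ⊆ S → InjectiveOn (α p) S →
    S ⊆ goodVars p
  ⊇core-injectiveOn⇒⊆goodVars C⁺⊆S injS {x} x∈S ((c , c∈core , αc≡x) , x∉core) =
    x∉core (subst (_∈ core p) c≡x c∈core)
    where
    c≡x : c ≡ x
    c≡x = injS c x (C⁺⊆S c∈core) x∈S (trans αc≡x (sym (∉core⇒fixed x∉core)))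

-- Maximality holds for every injective S ⊇ C⁺(α).
mainTheorem12 : (p : Prenaming) →
    (CoFinite (goodVars p) × InjectiveOn (α p) (goodVars p))
    × (∀ (S : Pred Var 0ℓ) → C⁺ p ⊆ S → goodVars p ⊆ S →
         InjectiveOn (α p) S → S ⊆ goodVars p)
mainTheorem12 p =
  (goodVars-coFinite p , goodVars-injective p) ,
  λ S C⁺⊆S _ → ⊇core-injectiveOn⇒⊆goodVars p {S} C⁺⊆S
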